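{- Let $A$ be a Scott closed irreducible subset of $\mathcal Z$ and let $f:\mathcal Z\to\mathcal T$, $f(m,s)=s$. Then $\sup f(A)$ exists in $\mathcal T$ and $\sup f(A)\in f(A)$.
   Context: Let $\omega_1$ be the first uncountable ordinal and $\mathbb W=[0,\omega_1)$ the set of countable ordinals with their usual order. Let $\mathbb W^*$ be the set of finite strings of elements of $\mathbb W$, with $\varepsilon$ the empty string; for $u\in\mathbb W$, $s\in\mathbb W^*$, $u.s$ is the string obtained by putting $u$ in front of $s$; for $s,t\in\mathbb W^*$, $ts$ is the concatenation of $t$ followed by $s$; for nonempty $t$, $\min(t)$ is the least ordinal occurring in $t$. On $\mathcal Z=\mathbb W\times\mathbb W^*$ define, for $m,m',u,u'\in\mathbb W$ and $s,t\in\mathbb W^*$: $(m,u.s)<_1(m,u'.s)$ iff $u<u'$; $(m,ts)<_2(m,s)$ iff $t\neq\varepsilon$; $(m,ts)<_3(m',s)$ iff $t\ne\varepsilon$ and $\min(t)\le m'$. With $R;S$ the relational composite, let $<\,=\,<_1\cup<_2\cup<_3\cup(<_2;<_1)\cup(<_3;<_1)$ and $\le\,=\,<\cup=$; this is a partial order and $\mathcal Z$ denotes the resulting poset. $\mathcal T$ is the poset $(\mathbb W^*,\sqsubseteq)$ where $u.s\sqsubset_1 u'.s$ iff $u<u'$, $ts\sqsubset_2 s$ iff $t\ne\varepsilon$, $\sqsubset\,=\,\sqsubset_1\cup\sqsubset_2\cup(\sqsubset_2;\sqsubset_1)$ and $\sqsubseteq\,=\,\sqsubset\cup=$ (a partial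 order). Scott closed sets: lower sets containing the supremum of each of their directed subsets whose supremum exists; a Scott closed set $C$ is irreducible if it is nonempty and $C\subseteq A\cup B$ with $A,B$ Scott closed implies $C\subseteq A$ or $C\subseteq B$. -}

module Defs where

open import Level using (0ℓ)
open import Data.Nat using (ℕ)
open import Data.List using (List; []; _∷_; _++_)
open import Data.Product using (Σ; ∃; ∃₂; _×_; _,_; proj₁; proj₂)
open import Data.Sum using (_⊎_)
open import Relation.Nullary using (¬_)
open import Relation.Unary using (Pred; _⊆_; _∪_)
open import Relation.Binary.PropositionalEquality using (_≡_)
open import Relation.Binary.Definitions using (Trichotomous; Transitive; tri<; tri≈; tri>)
open import Induction.WellFounded using (WellFounded)

-- The countable ordinals W = [0, ω₁), characterised (classically, up to
-- order isomorphism) as: a strict well-order in which every proper initial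
-- segment is countable, every ℕ-indexed sequence is bounded above, and the
-- whole set is uncountable.

record CountableOrdinals : Set₁ where
  field
    W        : Set
    _<_      : W → W → Set
    <-trans  : Transitive _<_
    <-tri    : Trichotomous _≡_ _<_
    <-wf     : WellFounded _<_
    segCountable : (α : W) → Σ (W → ℕ) λ h →
      (x y : W) → x < α → y < α → h x ≡ h y → x ≡ y
    seqBounded : (g : ℕ → W) → ∃ λ b → (n : ℕ) → g n < b
    uncountable : ¬ (Σ (W → ℕ) λ h → (x y : W) → h x ≡ h y → x ≡ y)

  _≤_ : W → W → Set
  x ≤ y = x < y ⊎ x ≡ y

  minL : W → List W → W
  minL x [] = x
  minL x (y ∷ ys) with <-tri x (minL y ys)
  ... | tri< _ _ _ = x
  ... | tri≈ _ _ _ = x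
  ... | tri> _ _ _ = minL y ys

module _ {X : Set} (_≼_ : X → X → Set) where

  IsUpperBound : Pred X 0ℓ → X → Set
  IsUpperBound D x = ∀ y → D y → y ≼ x

  IsSup : Pred X 0ℓ → X → Set
  IsSup D x = IsUpperBound D x × (∀ z → IsUpperBound D z → x ≼ z)

  IsLower : Pred X 0ℓ → Set
  IsLower C = ∀ x y → y ≼ x → C x → C y

  IsDirected : Pred X 0ℓ → Set
  IsDirected D = (∃ λ x → D x) ×
    (∀ x y → D x → D y → ∃ λ z → D z × x ≼ z × y ≼ z)

  IsScottClosed : Pred X 0ℓ → Set₁
  IsScottClosed C = IsLower C ×
    (∀ (D : Pred X 0ℓ) → D ⊆ C → IsDirected D → ∀ x → IsSup D x → C x)

  IsIrreducible : Pred X 0ℓ → Set₁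
  IsIrreducible C = (∃ λ x → C x) ×
    (∀ (A B : Pred X 0ℓ) → IsScottClosed A → IsScottClosed B →
       C ⊆ A ∪ B → (C ⊆ A) ⊎ (C ⊆ B))

_⨾_ : {X : Set} → (X → X → Set) → (X → X → Set) → X → X → Set
(R ⨾ S) p r = ∃ λ q → R p q × S q r

module Posets (O : CountableOrdinals) where
  open CountableOrdinals O

  W* : Set
  W* = List W

  Z : Set
  Z = W × W*

  _<₁_ : Z → Z → Set
  p <₁ q = ∃₂ λ m s → ∃₂ λ u u' →
    p ≡ (m , u ∷ s) × q ≡ (m , u' ∷ s) × u < u'

  _<₂_ : Z → Z → Set
  p <₂ q = ∃₂ λ x t → proj₁ p ≡ proj₁ q × proj₂ p ≡ (x ∷ t) ++ proj₂ q

  _<₃_ : Z → Z → Set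
  p <₃ q = ∃₂ λ x t → proj₂ p ≡ (x ∷ t) ++ proj₂ q × minL x t ≤ proj₁ q

  _<Z_ : Z → Z → Set
  p <Z q = p <₁ q ⊎ p <₂ q ⊎ p <₃ q ⊎ (_<₂_ ⨾ _<₁_) p q ⊎ (_<₃_ ⨾ _<₁_) p q

  _≤Z_ : Z → Z → Set
  p ≤Z q = p <Z q ⊎ p ≡ q

  _⊏₁_ : W* → W* → Set
  a ⊏₁ b = ∃₂ λ s u → ∃ λ u' → a ≡ u ∷ s × b ≡ u' ∷ s × u < u'

  _⊏₂_ : W* → W* → Set
  a ⊏₂ b = ∃₂ λ x t → a ≡ (x ∷ t) ++ b

  _⊏_ : W* → W* → Set
  a ⊏ b = a ⊏₁ b ⊎ a ⊏₂ b ⊎ (_⊏₂_ ⨾ _⊏₁_) a b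

  _⊑_ : W* → W* → Set
  a ⊑ b = a ⊏ b ⊎ a ≡ b

  f : Z → W*
  f = proj₂

  fImage : Pred Z 0ℓ → Pred W* 0ℓ
  fImage A s = ∃ λ m → A (m , s)

-- Take a point (m₀ , w₀) of A with w₀ shortest. If w₀ = ε, it is the top of 𝒯. Otherwise
-- w₀ = c₀.r and all strings of A are longer than r; splitting A by the suffix of length |r|,
-- irreducibility makes every string of A end in a letter followed by r. The chain of points
-- (m₀ , c.r) ∈ A has its supremum in A; as (m₀ , r) is too short to lie in A, these letters c
-- are bounded and their supremum β is their maximum. No point of A has a letter above β
-- before r: the levels m of points (m , c.r) ∈ A with c > β are bounded (otherwise, with γ the
-- least letter above β, all (m₀ , e.γ.r) lie in A and so does their supremum (m₀ , γ.r)), and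
-- for a bound ν, A is covered by the Scott closed sets "letter ≤ β" and "letter > β, or high
-- level, or some prefix letter ≤ ν", neither containing A. So β.r is the maximum of f(A).

module Submission where

open import Defs
open import Level using (0ℓ; suc; Lift; lift; lower)
open import Function using (_∘_; id)
open import Data.Product using (Σ; _×_; _,_; proj₁; proj₂)
open import Data.Sum using (_⊎_; inj₁; inj₂)
open import Data.Empty using (⊥; ⊥-elim)
open import Data.Unit using (⊤; tt)
open import Data.List using (List; []; _∷_; _++_; _∷ʳ_; length)
open import Data.List.Properties
  using (++-assoc; ++-identityʳ; ∷-injective; length-++-≤ʳ; ++-cancelʳ; ∷ʳ-injective)
open import Data.List.Relation.Unary.Any as Any using (Any; here; there)
open import Data.List.Relation.Unary.Any.Properties using (++⁺ˡ; ++⁺ʳ)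
import Data.Nat as ℕ
import Data.Nat.Properties as ℕ
open import Data.Nat.Induction using (<-wellFounded)
open import Relation.Unary using (Pred; _⊆_; _∪_; _∩_)
open import Relation.Nullary using (¬_; Dec; yes; no)
open import Relation.Binary.PropositionalEquality
  using (_≡_; refl; sym; trans; cong; subst; isEquivalence; resp₂; module ≡-Reasoning)
open import Relation.Binary.Definitions using (Transitive; Trans; tri<; tri≈; tri>)
open import Relation.Binary.Consequences using (tri⇒irr)
open import Relation.Binary.Construct.On using (wellFounded)
import Relation.Binary.Construct.StrictToNonStrict as NonStrict
open import Induction.WellFounded using (WellFounded; Acc; acc)
open import Axiom.ExcludedMiddle using (ExcludedMiddle)

maximum⇒IsSup : ∀ {X : Set} (_R_ : X → X → Set) {S : Pred X 0ℓ} {σ : X} →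
                IsUpperBound _R_ S σ → S σ → IsSup _R_ S σ
maximum⇒IsSup _ σ-ub σ∈S = σ-ub , λ _ z-ub → z-ub _ σ∈S

module _ {X : Set} where

  split-injective : ∀ (t₁ t₂ : List X) {c₁ c₂ : X} {r} → t₁ ++ c₁ ∷ r ≡ t₂ ++ c₂ ∷ r →
                    t₁ ≡ t₂ × c₁ ≡ c₂
  split-injective t₁ t₂ {c₁} {c₂} {r} eq =
    ∷ʳ-injective t₁ t₂ (++-cancelʳ r (t₁ ∷ʳ c₁) (t₂ ∷ʳ c₂) (begin
    (t₁ ∷ʳ c₁) ++ r  ≡⟨ ++-assoc t₁ (c₁ ∷ []) r ⟩
    t₁ ++ c₁ ∷ r     ≡⟨ eq ⟩
    t₂ ++ c₂ ∷ r     ≡⟨ sym (++-assoc t₂ (c₂ ∷ []) r) ⟩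
    (t₂ ∷ʳ c₂) ++ r  ∎))
    where open ≡-Reasoning

  ++-injectiveʳ-length : ∀ (t₁ t₂ : List X) {r₁ r₂ : List X} → t₁ ++ r₁ ≡ t₂ ++ r₂ →
                         length r₁ ≡ length r₂ → r₁ ≡ r₂
  ++-injectiveʳ-length [] [] eq _ = eq
  ++-injectiveʳ-length [] (_ ∷ t₂) {r₂ = r₂} refl len =
    ⊥-elim (ℕ.≤⇒≯ (length-++-≤ʳ r₂ {t₂}) (ℕ.≤-reflexive len))
  ++-injectiveʳ-length (_ ∷ t₁) [] {r₁} refl len =
    ⊥-elim (ℕ.≤⇒≯ (length-++-≤ʳ r₁ {t₁}) (ℕ.≤-reflexive (sym len)))
  ++-injectiveʳ-length (_ ∷ t₁) (_ ∷ t₂) eq len =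
    ++-injectiveʳ-length t₁ t₂ (proj₂ (∷-injective eq)) len

  splitAtLength : ∀ (r w : List X) → length r ℕ.< length w →
                  Σ (List X) λ t → Σ X λ c → Σ (List X) λ r' → w ≡ t ++ c ∷ r' × length r' ≡ length r
  splitAtLength r (a ∷ w) |r|<|w| with ℕ.m<1+n⇒m<n∨m≡n |r|<|w|
  ... | inj₂ |r|≡|w| = [] , a , w , refl , sym |r|≡|w|
  ... | inj₁ |r|<|w|' with splitAtLength r w |r|<|w|'
  ...   | t , c , r' , refl , len = a ∷ t , c , r' , refl , len

module Properties (O : CountableOrdinals) where
  open CountableOrdinals O
  open Posets O
  private module NS = NonStrict _≡_ _<_

  <-irrefl : ∀ {x} → ¬ (x < x)
  <-irrefl = tri⇒irr <-tri refl

  ≤-trans : Transitive _≤_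
  ≤-trans = NS.trans isEquivalence (resp₂ _<_) <-trans

  <-≤-trans : Trans _<_ _≤_ _<_
  <-≤-trans = NS.<-≤-trans <-trans (proj₁ (resp₂ _<_))

  ≤⇒≯ : ∀ {x y} → x ≤ y → ¬ (y < x)
  ≤⇒≯ x≤y y<x = <-irrefl (<-≤-trans y<x x≤y)

  ≮⇒≥ : ∀ {x y} → ¬ (x < y) → y ≤ x
  ≮⇒≥ {x} {y} x≮y with <-tri x y
  ... | tri< x<y _ _ = ⊥-elim (x≮y x<y)
  ... | tri≈ _ refl _ = inj₂ refl
  ... | tri> _ _ y<x = inj₁ y<x

  ≰⇒> : ∀ {x y} → ¬ (x ≤ y) → y < x
  ≰⇒> {x} {y} x≰y with <-tri x y
  ... | tri< x<y _ _ = ⊥-elim (x≰y (inj₁ x<y))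
  ... | tri≈ _ x≡y _ = ⊥-elim (x≰y (inj₂ x≡y))
  ... | tri> _ _ y<x = y<x

  minL≤head : ∀ x t → minL x t ≤ x
  minL≤head x [] = inj₂ refl
  minL≤head x (y ∷ ys) with <-tri x (minL y ys)
  ... | tri< _ _ _ = inj₂ refl
  ... | tri≈ _ _ _ = inj₂ refl
  ... | tri> _ _ y<x = inj₁ y<x

  minL≤minL-tail : ∀ x y ys → minL x (y ∷ ys) ≤ minL y ys
  minL≤minL-tail x y ys with <-tri x (minL y ys)
  ... | tri< x<y _ _ = inj₁ x<y
  ... | tri≈ _ x≡y _ = inj₂ x≡y
  ... | tri> _ _ _ = inj₂ refl

  Any≤⇒minL≤ : ∀ {m} x t → Any (_≤ m) (x ∷ t) → minL x t ≤ m
  Any≤⇒minL≤ x t (here x≤m) = ≤-trans (minL≤head x t) x≤m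
  Any≤⇒minL≤ x (y ∷ ys) (there p) = ≤-trans (minL≤minL-tail x y ys) (Any≤⇒minL≤ y ys p)

  minL≤⇒Any≤ : ∀ {m} x t → minL x t ≤ m → Any (_≤ m) (x ∷ t)
  minL≤⇒Any≤ x [] x≤m = here x≤m
  minL≤⇒Any≤ x (y ∷ ys) p with <-tri x (minL y ys)
  ... | tri< _ _ _ = here p
  ... | tri≈ _ _ _ = here p
  ... | tri> _ _ _ = there (minL≤⇒Any≤ y ys p)

  infix 4 _⊴_ _≼_

  data _⊴_ : W* → W* → Set where
    ⊴-refl : ∀ {w} → w ⊴ w
    ⊴-head : ∀ {u u' s} → u < u' → u ∷ s ⊴ u' ∷ s

  ⊴-cons : ∀ {u u' s} → u ≤ u' → u ∷ s ⊴ u' ∷ s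
  ⊴-cons (inj₁ u<u') = ⊴-head u<u'
  ⊴-cons (inj₂ refl) = ⊴-refl

  ⊴-length : ∀ {w v} → w ⊴ v → length w ≡ length v
  ⊴-length ⊴-refl = refl
  ⊴-length (⊴-head _) = refl

  ⊴-unconsˡ : ∀ {u s v} → u ∷ s ⊴ v → Σ W λ u' → v ≡ u' ∷ s × u ≤ u'
  ⊴-unconsˡ ⊴-refl = _ , refl , inj₂ refl
  ⊴-unconsˡ (⊴-head u<u') = _ , refl , inj₁ u<u'

  ⊴-unconsʳ : ∀ {w u' s} → w ⊴ u' ∷ s → Σ W λ u → w ≡ u ∷ s × u ≤ u'
  ⊴-unconsʳ ⊴-refl = _ , refl , inj₂ refl
  ⊴-unconsʳ (⊴-head u<u') = _ , refl , inj₁ u<u'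

  ⊴-raise : ∀ {w c c' s} → w ⊴ c ∷ s → c ≤ c' → w ⊴ c' ∷ s
  ⊴-raise w⊴ c≤c' with ⊴-unconsʳ w⊴
  ... | _ , refl , u≤c = ⊴-cons (≤-trans u≤c c≤c')

  ⊴-Any≤ : ∀ {m t' t} → t' ⊴ t → Any (_≤ m) t → Any (_≤ m) t'
  ⊴-Any≤ ⊴-refl p = p
  ⊴-Any≤ (⊴-head u<u') (here u'≤m) = here (inj₁ (<-≤-trans u<u' u'≤m))
  ⊴-Any≤ (⊴-head _) (there p) = there p

  ⊴-split : ∀ (t : W*) {c r w} → w ⊴ t ++ c ∷ r →
            (Σ W λ c' → t ≡ [] × w ≡ c' ∷ r × c' ≤ c) ⊎ (Σ W* λ t' → w ≡ t' ++ c ∷ r × t' ⊴ t)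
  ⊴-split [] w⊴ with ⊴-unconsʳ w⊴
  ... | c' , refl , c'≤c = inj₁ (c' , refl , refl , c'≤c)
  ⊴-split (x ∷ t) w⊴ with ⊴-unconsʳ w⊴
  ... | u , refl , u≤x = inj₂ (u ∷ t , refl , ⊴-cons u≤x)

  Admissible : W → W* → W → Set
  Admissible m t m' = m ≡ m' ⊎ Any (_≤ m') t

  Admissible-++ : ∀ {m t m'} t' → Admissible m t m' → Admissible m (t ++ t') m'
  Admissible-++ _ (inj₁ m≡m') = inj₁ m≡m'
  Admissible-++ _ (inj₂ p) = inj₂ (++⁺ˡ p)

  -- Normal form of ≤Z: the smaller string is t ++ b with b ⊴ the larger one. A nonempty t
  -- comes from <₂ or <₃, whose level conditions Admissible collects (min(t) ≤ m' read as
  -- Any (_≤ m') t); b ≢ the larger string comes from a trailing <₁.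
  data _≼_ : Z → Z → Set where
    ≼-intro : ∀ {m m' w v} t {b} → w ≡ t ++ b → b ⊴ v → Admissible m t m' → (m , w) ≼ (m' , v)

  ≤Z⇒≼ : ∀ {p q} → p ≤Z q → p ≼ q
  ≤Z⇒≼ (inj₂ refl) = ≼-intro [] refl ⊴-refl (inj₁ refl)
  ≤Z⇒≼ (inj₁ (inj₁ (_ , _ , _ , _ , refl , refl , u<u'))) = ≼-intro [] refl (⊴-head u<u') (inj₁ refl)
  ≤Z⇒≼ (inj₁ (inj₂ (inj₁ (x , t , m≡m' , w≡)))) = ≼-intro (x ∷ t) w≡ ⊴-refl (inj₁ m≡m')
  ≤Z⇒≼ (inj₁ (inj₂ (inj₂ (inj₁ (x , t , w≡ , min≤))))) =
    ≼-intro (x ∷ t) w≡ ⊴-refl (inj₂ (minL≤⇒Any≤ x t min≤))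
  ≤Z⇒≼ (inj₁ (inj₂ (inj₂ (inj₂ (inj₁ (_ , (x , t , m≡m' , w≡) , (_ , _ , _ , _ , refl , refl , u<u'))))))) =
    ≼-intro (x ∷ t) w≡ (⊴-head u<u') (inj₁ m≡m')
  ≤Z⇒≼ (inj₁ (inj₂ (inj₂ (inj₂ (inj₂ (_ , (x , t , w≡ , min≤) , (_ , _ , _ , _ , refl , refl , u<u'))))))) =
    ≼-intro (x ∷ t) w≡ (⊴-head u<u') (inj₂ (minL≤⇒Any≤ x t min≤))

  ≼⇒≤Z : ∀ {p q} → p ≼ q → p ≤Z q
  ≼⇒≤Z (≼-intro [] refl ⊴-refl (inj₁ refl)) = inj₂ refl
  ≼⇒≤Z (≼-intro [] refl (⊴-head u<u') (inj₁ refl)) = inj₁ (inj₁ (_ , _ , _ , _ , refl , refl , u<u'))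
  ≼⇒≤Z (≼-intro (x ∷ t) w≡ ⊴-refl (inj₁ m≡m')) = inj₁ (inj₂ (inj₁ (x , t , m≡m' , w≡)))
  ≼⇒≤Z (≼-intro (x ∷ t) w≡ ⊴-refl (inj₂ p)) = inj₁ (inj₂ (inj₂ (inj₁ (x , t , w≡ , Any≤⇒minL≤ x t p))))
  ≼⇒≤Z (≼-intro (x ∷ t) w≡ (⊴-head u<u') (inj₁ m≡m')) =
    inj₁ (inj₂ (inj₂ (inj₂ (inj₁ (_ , (x , t , m≡m' , w≡) , (_ , _ , _ , _ , refl , refl , u<u'))))))
  ≼⇒≤Z (≼-intro (x ∷ t) w≡ (⊴-head u<u') (inj₂ p)) =
    inj₁ (inj₂ (inj₂ (inj₂ (inj₂ (_ , (x , t , w≡ , Any≤⇒minL≤ x t p) , (_ , _ , _ , _ , refl , refl , u<u'))))))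

  ≼-sameLength : ∀ {p q} → p ≼ q → length (proj₂ p) ℕ.≤ length (proj₂ q) →
                 proj₁ p ≡ proj₁ q × proj₂ p ⊴ proj₂ q
  ≼-sameLength (≼-intro [] refl b⊴v (inj₁ m≡m')) _ = m≡m' , b⊴v
  ≼-sameLength (≼-intro (x ∷ t) {b} refl b⊴v _) |w|≤|v| =
    ⊥-elim (ℕ.≤⇒≯ (length-++-≤ʳ b {t})
                  (subst (length (x ∷ t ++ b) ℕ.≤_) (sym (⊴-length b⊴v)) |w|≤|v|))

  ≼-cons : ∀ {m c c' s} → c ≤ c' → (m , c ∷ s) ≼ (m , c' ∷ s)
  ≼-cons c≤c' = ≼-intro [] refl (⊴-cons c≤c') (inj₁ refl)

  ≼-consˡ : ∀ {m c s} → (m , c ∷ s) ≼ (m , s)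
  ≼-consˡ {c = c} = ≼-intro (c ∷ []) refl ⊴-refl (inj₁ refl)

  ≼-raiseHead : ∀ {p m c c' s} → p ≼ (m , c ∷ s) → c ≤ c' → p ≼ (m , c' ∷ s)
  ≼-raiseHead (≼-intro t w≡ b⊴ adm) c≤c' = ≼-intro t w≡ (⊴-raise b⊴ c≤c') adm

  ≼-dropHead : ∀ {p m e s} → p ≼ (m , e ∷ s) → p ≼ (m , s)
  ≼-dropHead {s = s} (≼-intro t refl b⊴ adm) with ⊴-unconsʳ b⊴
  ... | u , refl , _ = ≼-intro (t ∷ʳ u) (sym (++-assoc t (u ∷ []) s)) ⊴-refl (Admissible-++ (u ∷ []) adm)

  ≼-prepend : ∀ {m c s q} → (m , s) ≼ q → (m , c ∷ s) ≼ q
  ≼-prepend {c = c} (≼-intro t refl b⊴ (inj₁ m≡m')) = ≼-intro (c ∷ t) refl b⊴ (inj₁ m≡m')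
  ≼-prepend {c = c} (≼-intro t refl b⊴ (inj₂ p)) = ≼-intro (c ∷ t) refl b⊴ (inj₂ (there p))

  -- When the larger string is not longer than s, the letter c is part of the prefix.
  ≼-uncons : ∀ {m c s m' v} → (m , c ∷ s) ≼ (m' , v) → length v ℕ.≤ length s →
             (m , s) ≼ (m' , v) ⊎ (c ≤ m' × (∀ {c'} → c' ≤ m' → (m , c' ∷ s) ≼ (m' , v)))
  ≼-uncons (≼-intro [] refl b⊴v _) |v|≤|s| =
    ⊥-elim (ℕ.≤⇒≯ |v|≤|s| (ℕ.≤-reflexive (⊴-length b⊴v)))
  ≼-uncons (≼-intro (x ∷ t) refl b⊴v (inj₁ m≡m')) _ = inj₁ (≼-intro t refl b⊴v (inj₁ m≡m'))
  ≼-uncons (≼-intro (x ∷ t) refl b⊴v (inj₂ (there p))) _ = inj₁ (≼-intro t refl b⊴v (inj₂ p))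
  ≼-uncons (≼-intro (x ∷ t) refl b⊴v (inj₂ (here x≤m'))) _ =
    inj₂ (x≤m' , λ c'≤m' → ≼-intro (_ ∷ t) refl b⊴v (inj₂ (here c'≤m')))

  ProperSuffix : W* → W* → Set
  ProperSuffix r w = Σ W* λ t → Σ W λ c → w ≡ t ++ c ∷ r

  ≼-tail : ∀ {q p} (t : W*) {c r} → q ≼ p → proj₂ p ≡ t ++ c ∷ r →
           Σ W* λ t' → Σ W λ c' → proj₂ q ≡ t' ++ c' ∷ r × c' ≤ c
  ≼-tail t (≼-intro t₀ refl b⊴ _) refl with ⊴-split t b⊴
  ... | inj₁ (c' , _ , refl , c'≤c) = t₀ , c' , refl , c'≤c
  ... | inj₂ (t' , refl , _) = t₀ ++ t' , _ , sym (++-assoc t₀ t' _) , inj₂ refl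

  ≼-properSuffix : ∀ {q p r} → q ≼ p → ProperSuffix r (proj₂ p) → ProperSuffix r (proj₂ q)
  ≼-properSuffix q≼p (t , _ , e) with ≼-tail t q≼p e
  ... | t' , c' , e' , _ = t' , c' , e'

  ≼-keepsLetter : ∀ {q p} x (t : W*) {c r} → q ≼ p → proj₂ p ≡ (x ∷ t) ++ c ∷ r →
                  Σ W* λ t' → proj₂ q ≡ t' ++ c ∷ r
  ≼-keepsLetter x t (≼-intro t₀ refl b⊴ _) refl with ⊴-split (x ∷ t) b⊴
  ... | inj₁ (_ , () , _)
  ... | inj₂ (t' , refl , _) = t₀ ++ t' , sym (++-assoc t₀ t' _)

  properSuffix-unique : ∀ {r₁ r₂ w} → ProperSuffix r₁ w → ProperSuffix r₂ w →
                        length r₁ ≡ length r₂ → r₁ ≡ r₂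
  properSuffix-unique (t₁ , _ , refl) (t₂ , _ , w≡) len =
    proj₂ (∷-injective (++-injectiveʳ-length t₁ t₂ w≡ (cong ℕ.suc len)))

  ≼-letter : ∀ {q p} (t₁ t₂ : W*) {c₁ c₂ r} → q ≼ p →
             proj₂ q ≡ t₁ ++ c₁ ∷ r → proj₂ p ≡ t₂ ++ c₂ ∷ r → c₁ ≤ c₂
  ≼-letter t₁ t₂ q≼p e₁ e₂ with ≼-tail t₂ q≼p e₂
  ... | t' , c' , e' , c'≤c₂ =
    subst (_≤ _) (sym (proj₂ (split-injective t₁ t' (trans (sym e₁) e')))) c'≤c₂

  ⊴-head≤ : ∀ {u u' s s'} → u ∷ s ⊴ u' ∷ s' → u ≤ u'
  ⊴-head≤ u∷s⊴ with ⊴-unconsˡ u∷s⊴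
  ... | _ , refl , u≤u' = u≤u'

  ⊑-intro : ∀ {w v} t {b} → w ≡ t ++ b → b ⊴ v → w ⊑ v
  ⊑-intro [] refl ⊴-refl = inj₂ refl
  ⊑-intro [] refl (⊴-head u<u') = inj₁ (inj₁ (_ , _ , _ , refl , refl , u<u'))
  ⊑-intro (x ∷ t) w≡ ⊴-refl = inj₁ (inj₂ (inj₁ (x , t , w≡)))
  ⊑-intro (x ∷ t) w≡ (⊴-head u<u') = inj₁ (inj₂ (inj₂ (_ , (x , t , w≡) , (_ , _ , _ , refl , refl , u<u'))))

  Unbounded : Pred W 0ℓ → Set
  Unbounded V = ∀ μ → Σ W λ c → V c × μ < c

  chain : W → W* → Pred W 0ℓ → Pred Z 0ℓ
  chain m s V p = Σ W λ c → V c × p ≡ (m , c ∷ s)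

  chain-directed : ∀ {m s V c₀} → V c₀ → IsDirected _≤Z_ (chain m s V)
  chain-directed {m} {s} {V} v₀ = (_ , _ , v₀ , refl) , join
    where
    join : ∀ x y → chain m s V x → chain m s V y → Σ Z λ z → chain m s V z × x ≤Z z × y ≤Z z
    join _ _ (c₁ , v₁ , refl) (c₂ , v₂ , refl) with <-tri c₁ c₂
    ... | tri< c₁<c₂ _ _ = _ , (c₂ , v₂ , refl) , ≼⇒≤Z (≼-cons (inj₁ c₁<c₂)) , inj₂ refl
    ... | tri≈ _ refl _ = _ , (c₂ , v₂ , refl) , inj₂ refl , inj₂ refl
    ... | tri> _ _ c₂<c₁ = _ , (c₁ , v₁ , refl) , inj₂ refl , ≼⇒≤Z (≼-cons (inj₁ c₂<c₁))

  chain-below : ∀ {m s V z} → IsUpperBound _≤Z_ (chain m s V) z → ∀ {c} → V c → (m , c ∷ s) ≼ z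
  chain-below z-ub v = ≤Z⇒≼ (z-ub _ (_ , v , refl))

  chain-longBound : ∀ {m s V c₀ m' v} → V c₀ → IsUpperBound _≤Z_ (chain m s V) (m' , v) →
                    ¬ (length v ℕ.≤ length s) →
                    m ≡ m' × Σ W λ u' → v ≡ u' ∷ s × IsUpperBound _≤_ V u'
  chain-longBound v₀ z-ub |v|≰|s| with ≼-sameLength (chain-below z-ub v₀) (ℕ.≰⇒> |v|≰|s|)
  ... | refl , c₀∷s⊴v with ⊴-unconsˡ c₀∷s⊴v
  ...   | u' , refl , _ = refl , u' , refl ,
          λ _ v-c → ⊴-head≤ (proj₂ (≼-sameLength (chain-below z-ub v-c) ℕ.≤-refl))

  chain-sup-unbounded : ∀ {m s V} → Unbounded V → IsSup _≤Z_ (chain m s V) (m , s)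
  chain-sup-unbounded {m} {s} {V} unbounded = (λ { _ (_ , _ , refl) → ≼⇒≤Z ≼-consˡ }) , least
    where
    least : ∀ z → IsUpperBound _≤Z_ (chain m s V) z → (m , s) ≤Z z
    least (m' , v) z-ub with length v ℕ.≤? length s | unbounded m'
    ... | yes |v|≤|s| | c , v-c , m'<c with ≼-uncons (chain-below z-ub v-c) |v|≤|s|
    ...   | inj₁ s≼v = ≼⇒≤Z s≼v
    ...   | inj₂ (c≤m' , _) = ⊥-elim (≤⇒≯ c≤m' m'<c)
    least (m' , v) z-ub | no |v|≰|s| | _ , v-c , _ with chain-longBound v-c z-ub |v|≰|s|
    ... | _ , u' , _ , ≤u' with unbounded u'
    ...   | c , v-c' , u'<c = ⊥-elim (≤⇒≯ (≤u' c v-c') u'<c)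

  Bounded : Pred W 0ℓ → Set
  Bounded V = Σ W (IsUpperBound _≤_ V)

  module Classical (lem : ExcludedMiddle (suc 0ℓ)) where

    dec : (P : Set) → Dec P
    dec P with lem {Lift (suc 0ℓ) P}
    ... | yes p = yes (lower p)
    ... | no ¬p = no (λ p → ¬p (lift p))

    wf⇒minimal : ∀ {X : Set} {_≺_ : X → X → Set} → WellFounded _≺_ → (P : Pred X 0ℓ) →
                 ∀ {x} → P x → Σ X λ y → P y × (∀ z → P z → ¬ (z ≺ y))
    wf⇒minimal {X} {_≺_} wf P {x} px = descend x (wf x) px
      where
      descend : ∀ x → Acc _≺_ x → P x → Σ X λ y → P y × (∀ z → P z → ¬ (z ≺ y))
      descend x (acc below) px with dec (Σ X λ z → z ≺ x × P z)
      ... | yes (z , z≺x , pz) = descend z (below z≺x) pz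
      ... | no ¬smaller = x , px , λ z pz z≺x → ¬smaller (z , z≺x , pz)

    least : (P : Pred W 0ℓ) → ∀ {x} → P x → Σ W λ y → P y × (∀ z → P z → y ≤ z)
    least P px with wf⇒minimal <-wf P px
    ... | y , py , minimal = y , py , λ z pz → ≮⇒≥ (minimal z pz)

    shortest : (P : Pred Z 0ℓ) → ∀ {p} → P p →
               Σ Z λ q → P q × (∀ q' → P q' → length (proj₂ q) ℕ.≤ length (proj₂ q'))
    shortest P pp with wf⇒minimal (wellFounded (length ∘ proj₂) <-wellFounded) P pp
    ... | q , pq , minimal = q , pq , λ q' pq' → ℕ.≮⇒≥ (minimal q' pq')

    bounded⊎unbounded : (V : Pred W 0ℓ) → Bounded V ⊎ Unbounded V
    bounded⊎unbounded V with dec (Bounded V)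
    ... | yes bounded = inj₁ bounded
    ... | no ¬bounded = inj₂ above
      where
      above : Unbounded V
      above μ with dec (Σ W λ c → V c × μ < c)
      ... | yes c = c
      ... | no ¬c = ⊥-elim (¬bounded (μ , λ c v → ≮⇒≥ (λ μ<c → ¬c (c , v , μ<c))))

    bounded⇒sup : ∀ {V} → Bounded V → Σ W (IsSup _≤_ V)
    bounded⇒sup {V} (_ , μ-ub) = least (IsUpperBound _≤_ V) μ-ub

    chain-sup : ∀ {m s V c₀ λ'} → V c₀ → IsSup _≤_ V λ' → IsSup _≤Z_ (chain m s V) (m , λ' ∷ s)
    chain-sup {m} {s} {V} {λ' = λ'} v₀ (λ'-ub , λ'-least) =
      (λ { _ (c , v , refl) → ≼⇒≤Z (≼-cons (λ'-ub c v)) }) , leastZ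
      where
      leastZ : ∀ z → IsUpperBound _≤Z_ (chain m s V) z → (m , λ' ∷ s) ≤Z z
      leastZ (m' , v) z-ub with length v ℕ.≤? length s
      ... | no |v|≰|s| with chain-longBound v₀ z-ub |v|≰|s|
      ...   | refl , u' , refl , ≤u' = ≼⇒≤Z (≼-cons (λ'-least u' ≤u'))
      leastZ (m' , v) z-ub | yes |v|≤|s| with dec ((m , s) ≼ (m' , v))
      ...   | yes s≼v = ≼⇒≤Z (≼-prepend s≼v)
      ...   | no s⋠v = ≼⇒≤Z (proj₂ (inPrefix v₀) (λ'-least m' λ _ v-c → proj₁ (inPrefix v-c)))
        where
        inPrefix : ∀ {c} → V c → c ≤ m' × (∀ {c'} → c' ≤ m' → (m , c' ∷ s) ≼ (m' , v))
        inPrefix v-c with ≼-uncons (chain-below z-ub v-c) |v|≤|s|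
        ... | inj₁ s≼v = ⊥-elim (s⋠v s≼v)
        ... | inj₂ c-inPrefix = c-inPrefix

    module ShortestElement (D : Pred Z 0ℓ) (D-directed : IsDirected _≤Z_ D) where
      private
        shortestD : Σ Z λ q → D q × (∀ q' → D q' → length (proj₂ q) ℕ.≤ length (proj₂ q'))
        shortestD = shortest D (proj₂ (proj₁ D-directed))

      d₀ : Z
      d₀ = proj₁ shortestD

      d₀∈D : D d₀
      d₀∈D = proj₁ (proj₂ shortestD)

      d₀-shortest : ∀ d → D d → length (proj₂ d₀) ℕ.≤ length (proj₂ d)
      d₀-shortest = proj₂ (proj₂ shortestD)

      -- A common upper bound of d and d₀ in D is no longer than d₀, so only its head can differ.
      cofinal : ∀ {e q} → proj₂ d₀ ≡ e ∷ q → ∀ {d} → D d →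
                Σ W λ e' → D (proj₁ d₀ , e' ∷ q) × d ≼ (proj₁ d₀ , e' ∷ q)
      cofinal d₀≡ {d} d∈D with proj₂ D-directed d d₀ d∈D d₀∈D
      ... | (m , w) , z∈D , d≤z , d₀≤z with ≼-sameLength (≤Z⇒≼ d₀≤z) (d₀-shortest _ z∈D)
      ...   | refl , d₀⊴z rewrite d₀≡ with ⊴-unconsˡ d₀⊴z
      ...     | e' , refl , _ = e' , z∈D , ≤Z⇒≼ d≤z

      sup≼ : ∀ {x y} → IsSup _≤Z_ D x → (∀ {d} → D d → d ≼ y) → x ≼ y
      sup≼ (_ , x-least) d≼y = ≤Z⇒≼ (x-least _ λ _ d∈D → ≼⇒≤Z (d≼y d∈D))

      sup≼tail : ∀ {e q x} → proj₂ d₀ ≡ e ∷ q → IsSup _≤Z_ D x → x ≼ (proj₁ d₀ , q)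
      sup≼tail d₀≡ x-sup = sup≼ x-sup λ d∈D → ≼-dropHead (proj₂ (proj₂ (cofinal d₀≡ d∈D)))

      sup≼head : ∀ {e q b x} → proj₂ d₀ ≡ e ∷ q → (∀ e' → D (proj₁ d₀ , e' ∷ q) → e' ≤ b) →
                 IsSup _≤Z_ D x → x ≼ (proj₁ d₀ , b ∷ q)
      sup≼head d₀≡ ≤b x-sup = sup≼ x-sup λ d∈D →
        let (e' , z∈D , d≼z) = cofinal d₀≡ d∈D in ≼-raiseHead d≼z (≤b e' z∈D)

      sup-level : ∀ {x} → IsSup _≤Z_ D x → proj₁ x ≡ proj₁ d₀
      sup-level {x} x-sup with length (proj₂ d₀) ℕ.≤? length (proj₂ x) | proj₂ d₀ in d₀≡
      ... | yes |d₀|≤|x| | _ = sym (proj₁ (≼-sameLength (≤Z⇒≼ (proj₁ x-sup d₀ d₀∈D)) |d₀|≤|x|))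
      ... | no |d₀|≰|x| | e ∷ q = proj₁ (≼-sameLength (sup≼tail d₀≡ x-sup) |x|≤|q|)
        where
        |x|≤|q| : length (proj₂ x) ℕ.≤ length q
        |x|≤|q| = ℕ.≤-pred (subst (λ w → length (proj₂ x) ℕ.< length w) d₀≡ (ℕ.≰⇒> |d₀|≰|x|))
      ... | no |d₀|≰|x| | [] = ⊥-elim (|d₀|≰|x| (subst (λ w → length w ℕ.≤ length (proj₂ x)) (sym d₀≡) ℕ.z≤n))

    module IrreducibleClosed (A : Pred Z 0ℓ) (A-closed : IsScottClosed _≤Z_ A)
                             (A-irreducible : IsIrreducible _≤Z_ A) where

      A-lower : ∀ {p q} → q ≼ p → A p → A q
      A-lower q≼p = proj₁ A-closed _ _ (≼⇒≤Z q≼p)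

      A-sup : ∀ {D x} → D ⊆ A → IsDirected _≤Z_ D → IsSup _≤Z_ D x → A x
      A-sup D⊆A D-directed x-sup = proj₂ A-closed _ D⊆A D-directed _ x-sup

      chain⊆A : ∀ {m s V} → (∀ {c} → V c → A (m , c ∷ s)) → chain m s V ⊆ A
      chain⊆A ⊆A (_ , v , refl) = ⊆A v

      A∩-closed : ∀ {P : Pred Z 0ℓ} → (∀ {p q} → q ≼ p → A p → P p → P q) →
                  (∀ {D x} → D ⊆ A ∩ P → IsDirected _≤Z_ D → IsSup _≤Z_ D x → A x → P x) →
                  IsScottClosed _≤Z_ (A ∩ P)
      A∩-closed P-lower P-sup =
        (λ p q q≤p (p∈A , Pp) → A-lower (≤Z⇒≼ q≤p) p∈A , P-lower (≤Z⇒≼ q≤p) p∈A Pp) ,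
        λ D D⊆ D-directed x x-sup →
          let x∈A = A-sup (proj₁ ∘ D⊆) D-directed x-sup in x∈A , P-sup D⊆ D-directed x-sup x∈A

      module ShortestPoint (m₀ c₀ : W) (r : W*) (a₀ : A (m₀ , c₀ ∷ r))
                           (r-shorter : ∀ q → A q → length r ℕ.< length (proj₂ q)) where

        TailIn : Pred W* 0ℓ → Pred Z 0ℓ
        TailIn Q p = Σ W* λ r' → length r' ≡ length r × Q r' × ProperSuffix r' (proj₂ p)

        A∩TailIn-closed : ∀ Q → IsScottClosed _≤Z_ (A ∩ TailIn Q)
        A∩TailIn-closed Q = A∩-closed tail-lower tail-sup
          where
          tail-lower : ∀ {p q} → q ≼ p → A p → TailIn Q p → TailIn Q q
          tail-lower q≼p _ (r' , len , Qr' , suffix) = r' , len , Qr' , ≼-properSuffix q≼p suffix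

          tail-sup : ∀ {D x} → D ⊆ A ∩ TailIn Q → IsDirected _≤Z_ D → IsSup _≤Z_ D x → A x → TailIn Q x
          tail-sup {x = x} D⊆ ((d , d∈D) , _) x-sup x∈A with splitAtLength r (proj₂ x) (r-shorter x x∈A)
          ... | t , c , r'' , x≡ , len'' with proj₂ (D⊆ d∈D)
          ...   | r' , len' , Qr' , d-suffix =
            r' , len' , Qr' , subst (λ r₀ → ProperSuffix r₀ (proj₂ x)) r''≡r' (t , c , x≡)
            where
            r''≡r' : r'' ≡ r'
            r''≡r' = properSuffix-unique (≼-properSuffix (≤Z⇒≼ (proj₁ x-sup d d∈D)) (t , c , x≡))
                                         d-suffix (trans len'' (sym len'))

        tail-cover : A ⊆ (A ∩ TailIn (_≡ r)) ∪ (A ∩ TailIn (λ r' → ¬ r' ≡ r))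
        tail-cover {p} p∈A with splitAtLength r (proj₂ p) (r-shorter p p∈A)
        ... | t , c , r' , p≡ , len with dec (r' ≡ r)
        ...   | yes r'≡r = inj₁ (p∈A , r' , len , r'≡r , t , c , p≡)
        ...   | no r'≢r = inj₂ (p∈A , r' , len , r'≢r , t , c , p≡)

        A-tail : ∀ {p} → A p → ProperSuffix r (proj₂ p)
        A-tail with proj₂ A-irreducible _ _ (A∩TailIn-closed _) (A∩TailIn-closed _) tail-cover
        ... | inj₁ A⊆ = λ p∈A → let (_ , _ , r'≡r , suffix) = proj₂ (A⊆ p∈A) in
                                 subst (λ r₀ → ProperSuffix r₀ _) r'≡r suffix
        ... | inj₂ A⊆ = λ _ → let (_ , len , r'≢r , suffix) = proj₂ (A⊆ a₀) in
                               ⊥-elim (r'≢r (properSuffix-unique suffix ([] , c₀ , refl) len))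

        U : Pred W 0ℓ
        U c = A (m₀ , c ∷ r)

        maxLetter : Σ W λ β → U β × IsUpperBound _≤_ U β
        maxLetter with bounded⊎unbounded U
        ... | inj₁ bounded =
          let (β , β-sup) = bounded⇒sup bounded in
          β , A-sup (chain⊆A id) (chain-directed a₀) (chain-sup a₀ β-sup) , proj₁ β-sup
        ... | inj₂ unbounded =
          ⊥-elim (ℕ.<-irrefl refl (r-shorter _ r∈A))
          where
          r∈A : A (m₀ , r)
          r∈A = A-sup (chain⊆A id) (chain-directed a₀) (chain-sup-unbounded unbounded)

        β : W
        β = proj₁ maxLetter

        β∈U : U β
        β∈U = proj₁ (proj₂ maxLetter)

        β-max : IsUpperBound _≤_ U β
        β-max = proj₂ (proj₂ maxLetter)

        Letter : Pred W 0ℓ → Pred Z 0ℓ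
        Letter P p = Σ W* λ t → Σ W λ c → proj₂ p ≡ t ++ c ∷ r × P c

        Letter-unique : ∀ {P : Pred W 0ℓ} {p} t {c} → proj₂ p ≡ t ++ c ∷ r → Letter P p → P c
        Letter-unique {P} t p≡ (t' , _ , p≡' , Pc') =
          subst P (sym (proj₂ (split-injective t t' (trans (sym p≡) p≡')))) Pc'

        Letter≤-lower : ∀ {b p q} → q ≼ p → Letter (_≤ b) p → Letter (_≤ b) q
        Letter≤-lower q≼p (t , _ , p≡ , c≤b) with ≼-tail t q≼p p≡
        ... | t' , c' , q≡ , c'≤c = t' , c' , q≡ , ≤-trans c'≤c c≤b

        HighLevel : Pred W 0ℓ
        HighLevel m = Σ W λ c → β < c × A (m , c ∷ r)

        highLevels-bounded : ∀ {c₁} → β < c₁ → ¬ Unbounded HighLevel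
        highLevels-bounded β<c₁ unbounded = ≤⇒≯ (β-max γ γ∈U) β<γ
          where
          γ-least : Σ W λ γ → β < γ × (∀ c → β < c → γ ≤ c)
          γ-least = least (β <_) β<c₁

          γ : W
          γ = proj₁ γ-least

          β<γ : β < γ
          β<γ = proj₁ (proj₂ γ-least)

          W-unbounded : Unbounded (λ _ → ⊤)
          W-unbounded μ = let (b , μ<b) = seqBounded (λ _ → μ) in b , tt , μ<b 0

          below-high : ∀ {e} → ⊤ → A (m₀ , e ∷ γ ∷ r)
          below-high {e} _ with unbounded e
          ... | _ , (c , β<c , a) , e<m =
            A-lower (≼-intro (e ∷ []) refl (⊴-cons (proj₂ (proj₂ γ-least) c β<c)) (inj₂ (here (inj₁ e<m)))) a

          γ∈U : U γ
          γ∈U = A-sup (chain⊆A below-high) (chain-directed {c₀ = γ} tt) (chain-sup-unbounded W-unbounded)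

        module BoundedHighLevels (ν : W) (ν-ub : IsUpperBound _≤_ HighLevel ν) where

          HighOrLowPrefix : Pred Z 0ℓ
          HighOrLowPrefix p =
            Σ W* λ t → Σ W λ c → proj₂ p ≡ t ++ c ∷ r × (HighLevel (proj₁ p) ⊎ Any (_≤ ν) t)

          mark-down : ∀ {m m' t₀ t' t} → Admissible m' t₀ m → t' ⊴ t →
                      HighLevel m ⊎ Any (_≤ ν) t → HighLevel m' ⊎ Any (_≤ ν) (t₀ ++ t')
          mark-down (inj₁ refl) _ (inj₁ high) = inj₁ high
          mark-down {m} (inj₂ low) _ (inj₁ high) =
            inj₂ (++⁺ˡ (Any.map (λ x≤m → ≤-trans x≤m (ν-ub m high)) low))
          mark-down {t₀ = t₀} _ t'⊴t (inj₂ low) = inj₂ (++⁺ʳ t₀ (⊴-Any≤ t'⊴t low))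

          HighOrLowPrefix-lower : ∀ {p q} → q ≼ p → HighOrLowPrefix p → HighOrLowPrefix q
          HighOrLowPrefix-lower (≼-intro t₀ refl b⊴ adm) (t , c , refl , mark) with ⊴-split t b⊴
          ... | inj₁ (c' , refl , refl , _) = t₀ ++ [] , c' , sym (++-assoc t₀ [] _) , mark-down adm ⊴-refl mark
          ... | inj₂ (t' , refl , t'⊴t) = t₀ ++ t' , c , sym (++-assoc t₀ t' _) , mark-down adm t'⊴t mark

          K : Pred Z 0ℓ
          K = A ∩ Letter (_≤ β)

          module K-Sup (D : Pred Z 0ℓ) (D⊆K : D ⊆ K) (D-directed : IsDirected _≤Z_ D) where
            open ShortestElement D D-directed

            sup-letter≤β : ∀ {x} → IsSup _≤Z_ D x → Letter (_≤ β) x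
            sup-letter≤β x-sup with proj₂ (D⊆K d₀∈D)
            ... | e ∷ q , c , d₀≡ , c≤β = Letter≤-lower (sup≼tail d₀≡ x-sup) (q , c , refl , c≤β)
            ... | [] , _ , d₀≡ , _ = Letter≤-lower (sup≼head d₀≡ heads≤β x-sup) ([] , β , refl , inj₂ refl)
              where
              heads≤β : ∀ e' → D (proj₁ d₀ , e' ∷ r) → e' ≤ β
              heads≤β e' d∈D = Letter-unique {p = proj₁ d₀ , e' ∷ r} [] refl (proj₂ (D⊆K d∈D))

          K-closed : IsScottClosed _≤Z_ K
          K-closed = A∩-closed (λ q≼p _ → Letter≤-lower q≼p)
                               (λ {D} D⊆K D-directed x-sup _ → K-Sup.sup-letter≤β D D⊆K D-directed x-sup)

          C : Pred Z 0ℓ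
          C = A ∩ (Letter (β <_) ∪ HighOrLowPrefix)

          C-lower : ∀ {p q} → q ≼ p → A p → (Letter (β <_) ∪ HighOrLowPrefix) p →
                    (Letter (β <_) ∪ HighOrLowPrefix) q
          C-lower q≼p _ (inj₂ mark) = inj₂ (HighOrLowPrefix-lower q≼p mark)
          C-lower {_ , _} q≼p p∈A (inj₁ ([] , c , refl , β<c)) =
            inj₂ (HighOrLowPrefix-lower q≼p ([] , c , refl , inj₁ (c , β<c , p∈A)))
          C-lower q≼p _ (inj₁ (x ∷ t , c , p≡ , β<c)) =
            let (t' , q≡) = ≼-keepsLetter x t q≼p p≡ in inj₁ (t' , c , q≡ , β<c)

          module C-Sup (D : Pred Z 0ℓ) (D⊆C : D ⊆ C) (D-directed : IsDirected _≤Z_ D) where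
            open ShortestElement D D-directed

            sup-marked : ∀ {x} tₓ {cₓ} → IsSup _≤Z_ D x → proj₂ x ≡ tₓ ++ cₓ ∷ r →
                         (∀ {d} → D d → HighOrLowPrefix d) → HighOrLowPrefix x
            sup-marked tₓ {cₓ} x-sup x≡ D-marked with dec (HighLevel (proj₁ d₀)) | D-marked d₀∈D
            ... | yes high | _ = tₓ , cₓ , x≡ , inj₁ (subst HighLevel (sym (sup-level x-sup)) high)
            ... | no ¬high | _ , _ , _ , inj₁ high = ⊥-elim (¬high high)
            ... | no ¬high | e ∷ q , c , d₀≡ , inj₂ _ with dec (Any (_≤ ν) q)
            ...   | yes low = HighOrLowPrefix-lower (sup≼tail d₀≡ x-sup) (q , c , refl , inj₂ low)
            ...   | no ¬low =
              HighOrLowPrefix-lower (sup≼head d₀≡ heads≤ν x-sup) (ν ∷ q , c , refl , inj₂ (here (inj₂ refl)))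
              where
              heads≤ν : ∀ e' → D (proj₁ d₀ , e' ∷ q ++ c ∷ r) → e' ≤ ν
              heads≤ν e' d∈D with D-marked d∈D
              ... | t , _ , d≡ , mark with proj₁ (split-injective (e' ∷ q) t d≡) | mark
              ...   | refl | inj₁ high = ⊥-elim (¬high high)
              ...   | refl | inj₂ (here e'≤ν) = e'≤ν
              ...   | refl | inj₂ (there low) = ⊥-elim (¬low low)

            sup-C : ∀ {x} → IsSup _≤Z_ D x → A x → (Letter (β <_) ∪ HighOrLowPrefix) x
            sup-C x-sup x∈A with A-tail x∈A
            ... | tₓ , cₓ , x≡ with dec (β < cₓ)
            ...   | yes β<cₓ = inj₁ (tₓ , cₓ , x≡ , β<cₓ)
            ...   | no β≮cₓ = inj₂ (sup-marked tₓ x-sup x≡ D-marked)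
              where
              D-marked : ∀ {d} → D d → HighOrLowPrefix d
              D-marked d∈D with proj₂ (D⊆C d∈D)
              ... | inj₂ mark = mark
              ... | inj₁ (t , c , d≡ , β<c) =
                let c≤cₓ = ≼-letter t tₓ (≤Z⇒≼ (proj₁ x-sup _ d∈D)) d≡ x≡ in
                ⊥-elim (≤⇒≯ (≤-trans c≤cₓ (≮⇒≥ β≮cₓ)) β<c)

          C-closed : IsScottClosed _≤Z_ C
          C-closed = A∩-closed C-lower (λ {D} D⊆C D-directed x-sup → C-Sup.sup-C D D⊆C D-directed x-sup)

          K∪C-cover : A ⊆ K ∪ C
          K∪C-cover p∈A with A-tail p∈A
          ... | t , c , p≡ with dec (c ≤ β)
          ...   | yes c≤β = inj₁ (p∈A , t , c , p≡ , c≤β)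
          ...   | no c≰β = inj₂ (p∈A , inj₁ (t , c , p≡ , ≰⇒> c≰β))

          -- (m₀ , β ∷ r) lies outside C, and any point with a letter above β lies outside K.
          letter≯β : ∀ {p} t {c} → A p → proj₂ p ≡ t ++ c ∷ r → ¬ (β < c)
          letter≯β {p} t p∈A p≡ β<c with proj₂ A-irreducible K C K-closed C-closed K∪C-cover
          ... | inj₁ A⊆K = ≤⇒≯ (Letter-unique {p = p} t p≡ (proj₂ (A⊆K p∈A))) β<c
          ... | inj₂ A⊆C with proj₂ (A⊆C β∈U)
          ...   | inj₁ letter = <-irrefl (Letter-unique {p = m₀ , β ∷ r} [] refl letter)
          ...   | inj₂ (t' , _ , β∷r≡ , mark) with proj₁ (split-injective [] t' β∷r≡) | mark
          ...     | refl | inj₁ (c' , β<c' , c'∈U) = ≤⇒≯ (β-max c' c'∈U) β<c'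

        A-letter≤β : ∀ {p} → A p → Letter (_≤ β) p
        A-letter≤β p∈A with A-tail p∈A
        ... | t , c , p≡ with dec (c ≤ β)
        ...   | yes c≤β = t , c , p≡ , c≤β
        ...   | no c≰β with bounded⊎unbounded HighLevel
        ...     | inj₁ (ν , ν-ub) = ⊥-elim (BoundedHighLevels.letter≯β ν ν-ub t p∈A p≡ (≰⇒> c≰β))
        ...     | inj₂ unbounded = ⊥-elim (highLevels-bounded (≰⇒> c≰β) unbounded)

        sup-fImage : Σ W* λ σ → IsSup _⊑_ (fImage A) σ × fImage A σ
        sup-fImage = β ∷ r , maximum⇒IsSup _⊑_ below-β∷r (m₀ , β∈U) , (m₀ , β∈U)
          where
          below-β∷r : IsUpperBound _⊑_ (fImage A) (β ∷ r)
          below-β∷r w (_ , w∈A) = let (t , _ , w≡ , c≤β) = A-letter≤β w∈A in ⊑-intro t w≡ (⊴-cons c≤β)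

      sup-fImage : Σ W* λ σ → IsSup _⊑_ (fImage A) σ × fImage A σ
      sup-fImage with shortest A (proj₂ (proj₁ A-irreducible))
      ... | (m₀ , []) , a₀ , _ =
        [] , maximum⇒IsSup _⊑_ below-ε (m₀ , a₀) , (m₀ , a₀)
        where
        below-ε : IsUpperBound _⊑_ (fImage A) []
        below-ε w _ = ⊑-intro w (sym (++-identityʳ w)) ⊴-refl
      ... | (m₀ , c₀ ∷ r) , a₀ , a₀-shortest = ShortestPoint.sup-fImage m₀ c₀ r a₀ a₀-shortest

mainTheorem12 : ExcludedMiddle (suc 0ℓ) → (O : CountableOrdinals) →
    let open Posets O in
    (A : Pred Z 0ℓ) → IsScottClosed _≤Z_ A → IsIrreducible _≤Z_ A →
    Σ W* (λ σ → IsSup _⊑_ (fImage A) σ × fImage A σ)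
mainTheorem12 lem O = Properties.Classical.IrreducibleClosed.sup-fImage O lem
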